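{- Let $a_1,\dots,a_\mu, c_1,\dots,c_\nu$ be positive integers and $b_1,\dots,b_\mu, d_1,\dots,d_\nu$ be any integers. Suppose that for every $t\in\mathbb{Z}$ there is an equality of multisets $$\bigcup_{i=1}^{\mu} S(a_i, t b_i) = \bigcup_{j=1}^{\nu} S(c_j, t d_j).$$ Then $\mu=\nu$, and the indices can be reordered so that for each $i=1,\dots,\mu$ we have $a_i = c_i$ and $b_i \equiv d_i \pmod{a_i}$.
   Context: For a positive integer $a$ and an integer $b$, $S(a,b)$ denotes the arithmetic progression (residue class) $\{x\in\mathbb{Z} : x\equiv b \pmod a\}$. Unions are multiset unions: an integer is counted once for each progression containing it. -}

module Defs where

open import Data.Nat using (ℕ; zero; suc)
open import Data.Nat.Divisibility using (_∣?_)
open import Data.Integer using (ℤ; +_; _-_; _*_; ∣_∣)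
open import Data.Integer.Divisibility using (_∣_)
open import Data.Fin using (Fin)
open import Relation.Nullary.Decidable using (Dec; yes; no)

_∈S[_,_] : ℤ → ℕ → ℤ → Set
x ∈S[ a , b ] = (+ a) ∣ (x - b)

∈S? : (x : ℤ) (a : ℕ) (b : ℤ) → Dec (x ∈S[ a , b ])
∈S? x a b = a ∣? ∣ x - b ∣

multiplicity : (n : ℕ) → (Fin n → ℕ) → (Fin n → ℤ) → ℤ → ℤ → ℕ
multiplicity zero a b t x = 0
multiplicity (suc n) a b t x with ∈S? x (a Fin.zero) (t * b Fin.zero)
... | yes _ = suc (multiplicity n (λ i → a (Fin.suc i)) (λ i → b (Fin.suc i)) t x)
... | no _ = multiplicity n (λ i → a (Fin.suc i)) (λ i → b (Fin.suc i)) t x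

module Submission where

open import Defs
open import Data.Nat using (ℕ; NonZero)
open import Data.Integer using (ℤ; +_; _-_; ∣_∣)
open import Data.Integer.Divisibility using (_∣_)
open import Data.Fin using (Fin)
open import Data.Fin.Permutation using (Permutation; _⟨$⟩ʳ_)
open import Data.Product using (Σ; _×_; _,_)
open import Relation.Binary.PropositionalEquality using (_≡_; refl; sym; trans)

open import Data.Bool.Base using (if_then_else_)
open import Data.Fin as Fin using (toℕ; punchIn; punchOut)
import Data.Fin.Permutation as Perm
import Data.Fin.Properties as FinP
import Data.Integer as ℤ
open import Data.Integer.DivMod using (_%ℕ_; _/ℕ_; a≡a%ℕn+[a/ℕn]*n)
open import Data.Integer.Divisibility.Signed as ℤ∣ using (divides; ∣ᵤ⇒∣; ∣⇒∣ᵤ)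
  renaming (_∣_ to _∣ℤ_; _∣?_ to _∣ℤ?_)
open import Data.Integer.Properties using (pos-+; pos-*; +-inverseʳ; ∣i-j∣≡∣j-i∣)
open import Data.Integer.Tactic.RingSolver using (solve-∀)
open import Data.Nat as ℕ using (zero; suc; _+_; _*_; _!; _≤_; _<_; z≤n)
open import Data.Nat.Divisibility as ℕ∣ using () renaming (_∣_ to _∣ℕ_; _∣?_ to _∣ℕ?_)
open import Data.Nat.GCD using (gcd; gcd[m,n]∣m; gcd[m,n]∣n; gcd[m,n]≢0; gcd-identityʳ; gcd-GCD; module Bézout)
import Data.Nat.Properties as ℕ
open import Data.Nat.Tactic.RingSolver using () renaming (solve-∀ to ℕ-solve-∀)
open import Data.Product using (∃; ∃₂; proj₁; proj₂)
open import Data.Sum using (inj₁)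
open import Relation.Binary.PropositionalEquality using (_≢_; cong; cong₂; subst; module ≡-Reasoning)
open import Relation.Nullary.Decidable using (Dec; yes; no; does)
open import Relation.Nullary.Negation using (¬_; contradiction)
open import Algebra.Properties.Semiring.Sum ℕ.+-*-semiring
  using (sum; sum-syntax; sum-cong-≗; sum-replicate-zero; sum-init-last; sum-remove; ∑-comm; ∑-distrib-+; *-distribˡ-sum)

-- At t = x = 0 every class contains x, so μ = ν. The bijection is built by induction, removing
-- one congruent pair of classes at a time. To find a pair, let A = aᵢ be the largest modulus on
-- either side and β = bᵢ, and sum the multiplicities over the points x = β·t + r, 0 ≤ t < L = A!.
-- The class S(a, t·b) contributes the number of t < L with a ∣ r + (β - b)·t, which by Bézout is
-- a fixed positive weight times [g ∣ r], where g = gcd(a, |β - b|) is the level of the class.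
-- So both sides have the same weighted counts of levels dividing r, for every r ≥ 1, and an
-- inversion of divisor sums gives them the same weight at every level. Class i has level
-- gcd(A, 0) = A, so the other side has a class of level A: its modulus is a multiple of A, hence
-- equal to A, and its offset is congruent to β modulo A.

𝟙 : ∀ {p} {P : Set p} → Dec P → ℕ
𝟙 P? = if does P? then 1 else 0

𝟙-cong : ∀ {p q} {P : Set p} {Q : Set q} → (P → Q) → (Q → P) → (P? : Dec P) (Q? : Dec Q) → 𝟙 P? ≡ 𝟙 Q?
𝟙-cong P⇒Q Q⇒P (yes p) (yes q) = refl
𝟙-cong P⇒Q Q⇒P (yes p) (no ¬q) = contradiction (P⇒Q p) ¬q
𝟙-cong P⇒Q Q⇒P (no ¬p) (yes q) = contradiction (Q⇒P q) ¬p
𝟙-cong P⇒Q Q⇒P (no ¬p) (no ¬q) = refl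

𝟙-yes : ∀ {p} {P : Set p} → P → (P? : Dec P) → 𝟙 P? ≡ 1
𝟙-yes p (yes _) = refl
𝟙-yes p (no ¬p) = contradiction p ¬p

𝟙-no : ∀ {p} {P : Set p} → ¬ P → (P? : Dec P) → 𝟙 P? ≡ 0
𝟙-no ¬p (yes p) = contradiction p ¬p
𝟙-no ¬p (no _) = refl

𝟙-witness : ∀ {p} {P : Set p} (P? : Dec P) w → w * 𝟙 P? ≢ 0 → P
𝟙-witness (yes p) w _ = p
𝟙-witness (no _) w w*0≢0 = contradiction (ℕ.*-zeroʳ w) w*0≢0

𝟙-offset : ∀ {n} x d {y} → n ∣ℤ d → x ℤ.+ d ≡ y → 𝟙 (n ∣ℤ? x) ≡ 𝟙 (n ∣ℤ? y)
𝟙-offset {n} x d {y} n∣d x+d≡y = 𝟙-cong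
  (λ n∣x → subst (n ∣ℤ_) x+d≡y (ℤ∣.∣m∣n⇒∣m+n n∣x n∣d))
  (λ n∣y → ℤ∣.∣m+n∣n⇒∣m (subst (n ∣ℤ_) (sym x+d≡y) n∣y) n∣d)
  (n ∣ℤ? x) (n ∣ℤ? y)

term≤sum : ∀ {n} (f : Fin n → ℕ) i → f i ≤ sum f
term≤sum {suc n} f i = subst (f i ≤_) (sym (sum-remove f)) (ℕ.m≤m+n (f i) _)

nonzero-term : ∀ n (f : Fin n → ℕ) → sum f ≢ 0 → ∃ λ i → f i ≢ 0
nonzero-term zero f sum≢0 = contradiction refl sum≢0
nonzero-term (suc n) f sum≢0 with f Fin.zero ℕ.≟ 0
... | no f₀≢0 = Fin.zero , f₀≢0
... | yes f₀≡0 =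
  let (i , fᵢ≢0) = nonzero-term n (λ i → f (Fin.suc i)) (λ rest≡0 → sum≢0 (cong₂ ℕ._+_ f₀≡0 rest≡0))
  in Fin.suc i , fᵢ≢0

window-step : ∀ L (f : ℕ → ℕ) → ∑[ v < L ] f (suc (toℕ v)) + f 0 ≡ ∑[ v < L ] f (toℕ v) + f L
window-step L f = begin
  ∑[ v < L ] f (suc (toℕ v)) + f 0                      ≡⟨ ℕ.+-comm _ (f 0) ⟩
  ∑[ v < suc L ] f (toℕ v)                              ≡⟨ sum-init-last {L} (λ v → f (toℕ v)) ⟩
  ∑[ v < L ] f (toℕ (Fin.inject₁ v)) + f (toℕ (Fin.fromℕ L))
    ≡⟨ cong₂ _+_ (sum-cong-≗ {L} (λ v → cong f (FinP.toℕ-inject₁ v))) (cong f (FinP.toℕ-fromℕ L)) ⟩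
  ∑[ v < L ] f (toℕ v) + f L                            ∎
  where open ≡-Reasoning

periodic-window : ∀ L (f : ℕ → ℕ) → (∀ v → f (v + L) ≡ f v)
  → ∀ c → ∑[ v < L ] f (toℕ v + c) ≡ ∑[ v < L ] f (toℕ v)
periodic-window L f periodic zero = sum-cong-≗ {L} (λ v → cong f (ℕ.+-identityʳ (toℕ v)))
periodic-window L f periodic (suc c) = begin
  ∑[ v < L ] f (toℕ v + suc c)  ≡⟨ sum-cong-≗ {L} (λ v → cong f (ℕ.+-suc (toℕ v) c)) ⟩
  ∑[ v < L ] g (suc (toℕ v))
    ≡⟨ ℕ.+-cancelʳ-≡ _ _ _ (trans (window-step L g) (cong (λ z → ∑[ v < L ] g (toℕ v) + z) gL≡g0)) ⟩
  ∑[ v < L ] g (toℕ v)          ≡⟨ periodic-window L f periodic c ⟩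
  ∑[ v < L ] f (toℕ v)          ∎
  where
  open ≡-Reasoning
  g : ℕ → ℕ
  g u = f (u + c)
  gL≡g0 : g L ≡ g 0
  gL≡g0 = trans (cong f (ℕ.+-comm L c)) (periodic c)

bezout-mod : ∀ a m → ∃ λ Y → (+ a) ∣ℤ (+ gcd a m ℤ.+ Y ℤ.* + m)
bezout-mod a m with Bézout.identity (gcd-GCD a m)
... | Bézout.+- x y eq = + y , divides (+ x) (begin
  + g ℤ.+ + y ℤ.* + m  ≡⟨ cong (λ z → + g ℤ.+ z) (pos-* y m) ⟨
  + g ℤ.+ + (y * m)    ≡⟨ pos-+ g (y * m) ⟨
  + (g + y * m)        ≡⟨ cong +_ eq ⟩
  + (x * a)            ≡⟨ pos-* x a ⟩
  + x ℤ.* + a          ∎)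
  where
  open ≡-Reasoning
  g = gcd a m
... | Bézout.-+ x y eq = ℤ.- + y , divides (ℤ.- + x) (begin
  + g ℤ.+ ℤ.- + y ℤ.* + m        ≡⟨ neg-* (+ g) (+ y) (+ m) ⟩
  + g ℤ.+ ℤ.- (+ y ℤ.* + m)      ≡⟨ cong (λ z → + g ℤ.+ ℤ.- z) (pos-* y m) ⟨
  + g ℤ.+ ℤ.- + (y * m)          ≡⟨ cong (λ z → + g ℤ.+ ℤ.- + z) eq ⟨
  + g ℤ.+ ℤ.- + (g + x * a)      ≡⟨ cong (λ z → + g ℤ.+ ℤ.- z) (trans (pos-+ g _) (cong (λ z → + g ℤ.+ z) (pos-* x a))) ⟩
  + g ℤ.+ ℤ.- (+ g ℤ.+ + x ℤ.* + a) ≡⟨ cancel (+ g) (+ x) (+ a) ⟩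
  ℤ.- + x ℤ.* + a                ∎)
  where
  open ≡-Reasoning
  g = gcd a m
  cancel : ∀ G X A → G ℤ.+ ℤ.- (G ℤ.+ X ℤ.* A) ≡ ℤ.- X ℤ.* A
  cancel = solve-∀
  neg-* : ∀ G Y M → G ℤ.+ ℤ.- Y ℤ.* M ≡ G ℤ.+ ℤ.- (Y ℤ.* M)
  neg-* = solve-∀

bezout-solution : ∀ a k r .{{_ : NonZero a}} → gcd a ∣ k ∣ ∣ℕ r
  → ∃ λ c → (+ a) ∣ℤ (+ r ℤ.+ k ℤ.* + c)
bezout-solution a k r (ℕ∣.divides s r≡s*g) = c , a∣r+kc
  where
  Y₀ = proj₁ (bezout-mod a ∣ k ∣)
  q = ℤ∣._∣_.quotient (ℤ∣.m∣∣m∣ {k})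
  -- |k| = q·k, so Y = s·Y₀·q turns Bézout's identity into a ∣ r + Y·k
  Y = + s ℤ.* (Y₀ ℤ.* q)
  a∣r+Yk : (+ a) ∣ℤ (+ r ℤ.+ Y ℤ.* k)
  a∣r+Yk = subst ((+ a) ∣ℤ_) rearrange (ℤ∣.∣n⇒∣m*n (+ s) (proj₂ (bezout-mod a ∣ k ∣)))
    where
    scale : ∀ S G Y₀ q k → S ℤ.* (G ℤ.+ Y₀ ℤ.* (q ℤ.* k)) ≡ S ℤ.* G ℤ.+ (S ℤ.* (Y₀ ℤ.* q)) ℤ.* k
    scale = solve-∀
    rearrange : + s ℤ.* (+ gcd a ∣ k ∣ ℤ.+ Y₀ ℤ.* + ∣ k ∣) ≡ + r ℤ.+ Y ℤ.* k
    rearrange = begin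
      + s ℤ.* (+ gcd a ∣ k ∣ ℤ.+ Y₀ ℤ.* + ∣ k ∣)       ≡⟨ cong (λ z → + s ℤ.* (+ gcd a ∣ k ∣ ℤ.+ Y₀ ℤ.* z)) (ℤ∣._∣_.equality (ℤ∣.m∣∣m∣ {k})) ⟩
      + s ℤ.* (+ gcd a ∣ k ∣ ℤ.+ Y₀ ℤ.* (q ℤ.* k))    ≡⟨ scale (+ s) (+ gcd a ∣ k ∣) Y₀ q k ⟩
      + s ℤ.* + gcd a ∣ k ∣ ℤ.+ Y ℤ.* k             ≡⟨ cong (λ z → z ℤ.+ Y ℤ.* k) (trans (cong +_ r≡s*g) (pos-* s _)) ⟨
      + r ℤ.+ Y ℤ.* k                               ∎
      where open ≡-Reasoning
  c = Y %ℕ a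
  a∣r+kc : (+ a) ∣ℤ (+ r ℤ.+ k ℤ.* + c)
  a∣r+kc = ℤ∣.∣m+n∣n⇒∣m (subst ((+ a) ∣ℤ_) split a∣r+Yk) (ℤ∣.∣n⇒∣m*n ((Y /ℕ a) ℤ.* k) (ℤ∣.∣-refl {+ a}))
    where
    regroup : ∀ R k C Q A → R ℤ.+ (C ℤ.+ Q ℤ.* A) ℤ.* k ≡ (R ℤ.+ k ℤ.* C) ℤ.+ (Q ℤ.* k) ℤ.* A
    regroup = solve-∀
    split : + r ℤ.+ Y ℤ.* k ≡ (+ r ℤ.+ k ℤ.* + c) ℤ.+ ((Y /ℕ a) ℤ.* k) ℤ.* + a
    split = trans (cong (λ z → + r ℤ.+ z ℤ.* k) (a≡a%ℕn+[a/ℕn]*n Y a)) (regroup (+ r) k (+ c) (Y /ℕ a) (+ a))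

solves : ℕ → ℤ → ℕ → ℕ → ℕ
solves a k r v = 𝟙 ((+ a) ∣ℤ? (+ r ℤ.+ k ℤ.* + v))

solutions : ℕ → ℤ → ℕ → ℕ → ℕ
solutions a k L r = ∑[ v < L ] solves a k r (toℕ v)

solvable⇒gcd∣ : ∀ a k r v → (+ a) ∣ℤ (+ r ℤ.+ k ℤ.* + v) → gcd a ∣ k ∣ ∣ℕ r
solvable⇒gcd∣ a k r v a∣r+kv = ∣⇒∣ᵤ {+ gcd a ∣ k ∣} {+ r} (ℤ∣.∣m+n∣n⇒∣m (ℤ∣.∣-trans g∣a a∣r+kv) (ℤ∣.∣m⇒∣m*n (+ v) g∣k))
  where
  g∣a : (+ gcd a ∣ k ∣) ∣ℤ (+ a)
  g∣a = ∣ᵤ⇒∣ {+ gcd a ∣ k ∣} {+ a} (gcd[m,n]∣m a ∣ k ∣)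
  g∣k : (+ gcd a ∣ k ∣) ∣ℤ k
  g∣k = ∣ᵤ⇒∣ {+ gcd a ∣ k ∣} {k} (gcd[m,n]∣n a ∣ k ∣)

-- If a ∣ L and the congruence a ∣ r + k·c has a solution c, then it has as many solutions
-- below L as the homogeneous congruence a ∣ k·v: v ↦ v + c shifts one set onto the other
-- modulo L.
solutions-shift : ∀ a k L r c → a ∣ℕ L → (+ a) ∣ℤ (+ r ℤ.+ k ℤ.* + c)
  → solutions a k L r ≡ solutions a k L 0
solutions-shift a k L r c a∣L a∣r+kc = begin
  ∑[ v < L ] solves a k r (toℕ v)      ≡⟨ periodic-window L (solves a k r) period c ⟨
  ∑[ v < L ] solves a k r (toℕ v + c)  ≡⟨ sum-cong-≗ {L} (λ v → sym (𝟙-offset (+ 0 ℤ.+ k ℤ.* + toℕ v) _ a∣r+kc (shift (+ r) k (toℕ v) c))) ⟩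
  ∑[ v < L ] solves a k 0 (toℕ v)      ∎
  where
  open ≡-Reasoning
  period-identity : ∀ R k u L → (R ℤ.+ k ℤ.* + u) ℤ.+ k ℤ.* + L ≡ R ℤ.+ k ℤ.* + (u + L)
  period-identity R k u L = trans (ring R k (+ u) (+ L)) (sym (cong (λ z → R ℤ.+ k ℤ.* z) (pos-+ u L)))
    where
    ring : ∀ R k U L → (R ℤ.+ k ℤ.* U) ℤ.+ k ℤ.* L ≡ R ℤ.+ k ℤ.* (U ℤ.+ L)
    ring = solve-∀
  shift : ∀ R k u c → (+ 0 ℤ.+ k ℤ.* + u) ℤ.+ (R ℤ.+ k ℤ.* + c) ≡ R ℤ.+ k ℤ.* + (u + c)
  shift R k u c = trans (ring R k (+ u) (+ c)) (sym (cong (λ z → R ℤ.+ k ℤ.* z) (pos-+ u c)))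
    where
    ring : ∀ R k U C → (+ 0 ℤ.+ k ℤ.* U) ℤ.+ (R ℤ.+ k ℤ.* C) ≡ R ℤ.+ k ℤ.* (U ℤ.+ C)
    ring = solve-∀
  period : ∀ u → solves a k r (u + L) ≡ solves a k r u
  period u = sym (𝟙-offset (+ r ℤ.+ k ℤ.* + u) _ (ℤ∣.∣n⇒∣m*n k (∣ᵤ⇒∣ {+ a} {+ L} a∣L)) (period-identity (+ r) k u L))

solutions-formula : ∀ a k L r .{{_ : NonZero a}} → a ∣ℕ L
  → solutions a k L r ≡ solutions a k L 0 * 𝟙 (gcd a ∣ k ∣ ∣ℕ? r)
solutions-formula a k L r a∣L with gcd a ∣ k ∣ ∣ℕ? r
... | yes g∣r = let (c , a∣r+kc) = bezout-solution a k r g∣r in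
  trans (solutions-shift a k L r c a∣L a∣r+kc) (sym (ℕ.*-identityʳ _))
... | no g∤r = trans all-zero (sym (ℕ.*-zeroʳ (solutions a k L 0)))
  where
  all-zero : solutions a k L r ≡ 0
  all-zero = trans (sum-cong-≗ {L} (λ v → 𝟙-no (λ a∣ → g∤r (solvable⇒gcd∣ a k r (toℕ v) a∣))
                                                  ((+ a) ∣ℤ? (+ r ℤ.+ k ℤ.* + toℕ v))))
                   (sum-replicate-zero L)

-- v = 0 always solves a ∣ k·v, so a nonempty window contains a solution.
solutions-positive : ∀ a k L → 0 < L → 1 ≤ solutions a k L 0
solutions-positive a k (suc L) _ =
  subst (λ s → 1 ≤ s + ∑[ v < L ] solves a k 0 (suc (toℕ v))) (sym v=0-solves) (ℕ.m≤m+n 1 _)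
  where
  v=0-solves : solves a k 0 0 ≡ 1
  v=0-solves = 𝟙-yes (ℤ∣.∣m∣n⇒∣m+n a∣0 (ℤ∣.∣n⇒∣m*n k a∣0)) ((+ a) ∣ℤ? (+ 0 ℤ.+ k ℤ.* + 0))
    where
    a∣0 : (+ a) ∣ℤ + 0
    a∣0 = divides (+ 0) refl

⟪_,_⟫ : ∀ {n} → (Fin n → ℕ) → (Fin n → ℕ) → (ℕ → ℕ) → ℕ
⟪ g , w ⟫ f = sum (λ i → w i * f (g i))

⟪⟫-zero : ∀ {n} (g w : Fin n → ℕ) f → (∀ i → f (g i) ≡ 0) → ⟪ g , w ⟫ f ≡ 0
⟪⟫-zero {n} g w f f∘g≡0 =
  trans (sum-cong-≗ {n} (λ i → trans (cong (w i *_) (f∘g≡0 i)) (ℕ.*-zeroʳ (w i)))) (sum-replicate-zero n)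

⟪⟫-linear : ∀ {n} (g w : Fin n → ℕ) (c : ℕ) (f e d f₀ : ℕ → ℕ)
  → (∀ x → f x + c * e x ≡ c * d x + f₀ x)
  → ⟪ g , w ⟫ f + c * ⟪ g , w ⟫ e ≡ c * ⟪ g , w ⟫ d + ⟪ g , w ⟫ f₀
⟪⟫-linear {n} g w c f e d f₀ relation = begin
  ⟪ g , w ⟫ f + c * ⟪ g , w ⟫ e
    ≡⟨ cong (λ z → ⟪ g , w ⟫ f + z) (*-distribˡ-sum c (λ i → w i * e (g i))) ⟩
  ⟪ g , w ⟫ f + ∑[ i < n ] (c * (w i * e (g i)))
    ≡⟨ ∑-distrib-+ (λ i → w i * f (g i)) (λ i → c * (w i * e (g i))) ⟨
  ∑[ i < n ] (w i * f (g i) + c * (w i * e (g i)))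
    ≡⟨ sum-cong-≗ {n} (λ i → termwise (w i) (relation (g i))) ⟩
  ∑[ i < n ] (c * (w i * d (g i)) + w i * f₀ (g i))
    ≡⟨ ∑-distrib-+ (λ i → c * (w i * d (g i))) (λ i → w i * f₀ (g i)) ⟩
  ∑[ i < n ] (c * (w i * d (g i))) + ⟪ g , w ⟫ f₀
    ≡⟨ cong (λ z → z + ⟪ g , w ⟫ f₀) (*-distribˡ-sum c (λ i → w i * d (g i))) ⟨
  c * ⟪ g , w ⟫ d + ⟪ g , w ⟫ f₀ ∎
  where
  open ≡-Reasoning
  termwise : ∀ {F E D F₀} W → F + c * E ≡ c * D + F₀ → W * F + c * (W * E) ≡ c * (W * D) + W * F₀
  termwise {F} {E} {D} {F₀} W rel = begin
    W * F + c * (W * E)   ≡⟨ pull W F c E ⟩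
    W * (F + c * E)       ≡⟨ cong (W *_) rel ⟩
    W * (c * D + F₀)      ≡⟨ push W c D F₀ ⟩
    c * (W * D) + W * F₀  ∎
    where
    pull : ∀ W F c E → W * F + c * (W * E) ≡ W * (F + c * E)
    pull = ℕ-solve-∀
    push : ∀ W c D F₀ → W * (c * D + F₀) ≡ c * (W * D) + W * F₀
    push = ℕ-solve-∀

peel-top : ∀ D .{{_ : NonZero D}} (f : ℕ → ℕ) → (∀ x → D < x → f x ≡ 0) → ∀ x
  → f x + f D * (𝟙 (x ℕ.<? D) * 𝟙 (x ∣ℕ? D)) ≡ f D * 𝟙 (x ∣ℕ? D) + 𝟙 (x ℕ.<? D) * f x
peel-top D f vanish x with x ℕ.<? D
... | yes x<D rewrite 𝟙-yes x<D (x ℕ.<? D) = below (f x) (f D) (𝟙 (x ∣ℕ? D))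
  where
  below : ∀ F c δ → F + c * (1 * δ) ≡ c * δ + 1 * F
  below = ℕ-solve-∀
... | no x≮D with x ℕ.≟ D
...   | yes refl rewrite 𝟙-no x≮D (x ℕ.<? x) | 𝟙-yes (ℕ∣.∣-refl {x}) (x ∣ℕ? x) = top (f x)
  where
  top : ∀ F → F + F * (0 * 1) ≡ F * 1 + 0 * F
  top = ℕ-solve-∀
...   | no x≢D
  rewrite 𝟙-no x≮D (x ℕ.<? D)
        | vanish x (ℕ.≤∧≢⇒< (ℕ.≮⇒≥ x≮D) (λ D≡x → x≢D (sym D≡x)))
        | 𝟙-no (λ x∣D → x≮D (ℕ.≤∧≢⇒< (ℕ∣.∣⇒≤ x∣D) x≢D)) (x ∣ℕ? D) =
  sym (ℕ.+-identityʳ (f D * 0))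

-- By induction on the support bound H: the
-- top value f(H-1) is peeled off with the divisor indicator of H-1, leaving functions
-- supported below H-1.
divisor-inversion : ∀ {m n} (g w : Fin m → ℕ) (g′ w′ : Fin n → ℕ)
  → (∀ i → g i ≢ 0) → (∀ j → g′ j ≢ 0)
  → (∀ r → ⟪ g , w ⟫ (λ x → 𝟙 (x ∣ℕ? suc r)) ≡ ⟪ g′ , w′ ⟫ (λ x → 𝟙 (x ∣ℕ? suc r)))
  → ∀ H f → (∀ x → H ≤ x → f x ≡ 0) → ⟪ g , w ⟫ f ≡ ⟪ g′ , w′ ⟫ f
divisor-inversion g w g′ w′ g≢0 g′≢0 same-divisors = invert
  where
  -- levels are positive, so functions supported on {0} are invisible
  supported-at-0 : ∀ f → (∀ x → 1 ≤ x → f x ≡ 0) → ⟪ g , w ⟫ f ≡ ⟪ g′ , w′ ⟫ f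
  supported-at-0 f vanish = trans (⟪⟫-zero g w f (λ i → vanish (g i) (ℕ.n≢0⇒n>0 (g≢0 i))))
                                  (sym (⟪⟫-zero g′ w′ f (λ j → vanish (g′ j) (ℕ.n≢0⇒n>0 (g′≢0 j)))))
  invert : ∀ H f → (∀ x → H ≤ x → f x ≡ 0) → ⟪ g , w ⟫ f ≡ ⟪ g′ , w′ ⟫ f
  invert zero f vanish = supported-at-0 f (λ x _ → vanish x z≤n)
  invert (suc zero) f vanish = supported-at-0 f vanish
  invert (suc (suc r)) f vanish = ℕ.+-cancelʳ-≡ _ _ _ (begin
    ⟪ g , w ⟫ f + f D * ⟪ g , w ⟫ lower      ≡⟨ ⟪⟫-linear g w (f D) f lower δ f₀ peel ⟩
    f D * ⟪ g , w ⟫ δ + ⟪ g , w ⟫ f₀         ≡⟨ cong₂ (λ s t → f D * s + t) (same-divisors r) (invert (suc r) f₀ f₀-vanish) ⟩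
    f D * ⟪ g′ , w′ ⟫ δ + ⟪ g′ , w′ ⟫ f₀     ≡⟨ ⟪⟫-linear g′ w′ (f D) f lower δ f₀ peel ⟨
    ⟪ g′ , w′ ⟫ f + f D * ⟪ g′ , w′ ⟫ lower  ≡⟨ cong (λ s → ⟪ g′ , w′ ⟫ f + f D * s) (invert (suc r) lower lower-vanish) ⟨
    ⟪ g′ , w′ ⟫ f + f D * ⟪ g , w ⟫ lower    ∎)
    where
    open ≡-Reasoning
    D = suc r
    δ lower f₀ : ℕ → ℕ
    δ x = 𝟙 (x ∣ℕ? D)
    lower x = 𝟙 (x ℕ.<? D) * 𝟙 (x ∣ℕ? D)
    f₀ x = 𝟙 (x ℕ.<? D) * f x
    peel : ∀ x → f x + f D * lower x ≡ f D * δ x + f₀ x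
    peel = peel-top D f vanish
    lower-vanish : ∀ x → D ≤ x → lower x ≡ 0
    lower-vanish x D≤x rewrite 𝟙-no (ℕ.≤⇒≯ D≤x) (x ℕ.<? D) = refl
    f₀-vanish : ∀ x → D ≤ x → f₀ x ≡ 0
    f₀-vanish x D≤x rewrite 𝟙-no (ℕ.≤⇒≯ D≤x) (x ℕ.<? D) = refl

level-witness : ∀ {n} (g w : Fin n → ℕ) A → 1 ≤ ⟪ g , w ⟫ (λ x → 𝟙 (x ℕ.≟ A)) → ∃ λ j → g j ≡ A
level-witness {n} g w A positive =
  let (j , wⱼ·[gⱼ≡A]≢0) = nonzero-term n (λ j → w j * 𝟙 (g j ℕ.≟ A))
                            (λ sum≡0 → ℕ.<-irrefl (sym sum≡0) positive)
  in j , 𝟙-witness (g j ℕ.≟ A) (w j) wⱼ·[gⱼ≡A]≢0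

-- The count (0 or 1) of x in the residue class S(a, t·b). By the definitions of ∈S? and of the
-- signed divisibility test it is, definitionally, the indicator of (+ a) ∣ℤ x - t·b.
member : ℤ → ℤ → ℕ → ℤ → ℕ
member t x a b = 𝟙 (∈S? x a (t ℤ.* b))

multiplicity-sum : ∀ n (a : Fin n → ℕ) (b : Fin n → ℤ) t x
  → multiplicity n a b t x ≡ ∑[ i < n ] member t x (a i) (b i)
multiplicity-sum zero a b t x = refl
multiplicity-sum (suc n) a b t x with ∈S? x (a Fin.zero) (t ℤ.* b Fin.zero)
... | yes _ = cong suc (multiplicity-sum n _ _ t x)
... | no _ = multiplicity-sum n _ _ t x

multiplicity-origin : ∀ n (a : Fin n → ℕ) (b : Fin n → ℤ) → multiplicity n a b (+ 0) (+ 0) ≡ n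
multiplicity-origin zero a b = refl
multiplicity-origin (suc n) a b with ∈S? (+ 0) (a Fin.zero) (+ 0 ℤ.* b Fin.zero)
... | yes _ = cong suc (multiplicity-origin n _ _)
... | no 0∉S = contradiction (ℕ∣.divides 0 refl) 0∉S

SameClass : ℕ → ℤ → ℕ → ℤ → Set
SameClass a b c d = a ≡ c × (+ a) ∣ (b - d)

SameClass-sym : ∀ {a b c d} → SameClass a b c d → SameClass c d a b
SameClass-sym {b = b} {d = d} (refl , a∣b-d) = refl , subst (_ ∣ℕ_) (∣i-j∣≡∣j-i∣ b d) a∣b-d

member-class : ∀ {a b c d} → SameClass a b c d → ∀ t x → member t x a b ≡ member t x c d
member-class {a} {b} {c} {d} (refl , a∣b-d) t x =
  𝟙-offset (x - t ℤ.* b) (t ℤ.* (b - d)) (ℤ∣.∣n⇒∣m*n t (∣ᵤ⇒∣ {+ a} {b - d} a∣b-d)) (change-offset x t b d)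
  where
  change-offset : ∀ x t b d → (x - t ℤ.* b) ℤ.+ t ℤ.* (b - d) ≡ x - t ℤ.* d
  change-offset = solve-∀

SameUnion : ∀ {m n} → (Fin m → ℕ) → (Fin m → ℤ) → (Fin n → ℕ) → (Fin n → ℤ) → Set
SameUnion {m} {n} a b c d = ∀ t x → ∑[ i < m ] member t x (a i) (b i) ≡ ∑[ j < n ] member t x (c j) (d j)

levels : ∀ {n} → ℤ → (Fin n → ℕ) → (Fin n → ℤ) → Fin n → ℕ
levels β a b i = gcd (a i) ∣ β - b i ∣

weights : ∀ {n} → ℤ → ℕ → (Fin n → ℕ) → (Fin n → ℤ) → Fin n → ℕ
weights β L a b i = solutions (a i) (β - b i) L 0

-- Probing the union along the line x = β·t + r, 0 ≤ t < L: the class S(a, t·b) contains β·t + r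
-- exactly when a ∣ r + (β - b)·t, so if every modulus divides L the class is hit
-- weights β L a b times when its level divides r, and never otherwise.
probe : ∀ {n} (a : Fin n → ℕ) (b : Fin n → ℤ) β L r → (∀ i → NonZero (a i)) → (∀ i → a i ∣ℕ L)
  → ∑[ t < L ] (∑[ i < n ] member (+ toℕ t) (β ℤ.* + toℕ t ℤ.+ + r) (a i) (b i))
    ≡ ⟪ levels β a b , weights β L a b ⟫ (λ x → 𝟙 (x ∣ℕ? r))
probe {n} a b β L r a≢0 a∣L = begin
  ∑[ t < L ] (∑[ i < n ] member (+ toℕ t) (β ℤ.* + toℕ t ℤ.+ + r) (a i) (b i))
    ≡⟨ ∑-comm {L} {n} (λ t i → member (+ toℕ t) (β ℤ.* + toℕ t ℤ.+ + r) (a i) (b i)) ⟩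
  ∑[ i < n ] (∑[ t < L ] member (+ toℕ t) (β ℤ.* + toℕ t ℤ.+ + r) (a i) (b i))
    ≡⟨ sum-cong-≗ {n} (λ i → sum-cong-≗ {L} (λ t → cong (λ z → 𝟙 ((+ a i) ∣ℤ? z)) (on-line (b i) (+ toℕ t)))) ⟩
  ∑[ i < n ] solutions (a i) (β - b i) L r
    ≡⟨ sum-cong-≗ {n} (λ i → solutions-formula (a i) (β - b i) L r {{a≢0 i}} (a∣L i)) ⟩
  ⟪ levels β a b , weights β L a b ⟫ (λ x → 𝟙 (x ∣ℕ? r)) ∎
  where
  open ≡-Reasoning
  on-line′ : ∀ β b R T → (β ℤ.* T ℤ.+ R) - T ℤ.* b ≡ R ℤ.+ (β - b) ℤ.* T
  on-line′ = solve-∀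
  on-line : ∀ b T → (β ℤ.* T ℤ.+ + r) - T ℤ.* b ≡ + r ℤ.+ (β - b) ℤ.* T
  on-line b T = on-line′ β b (+ r) T

same-divisor-sums : ∀ {m n} (a : Fin m → ℕ) (b : Fin m → ℤ) (c : Fin n → ℕ) (d : Fin n → ℤ)
  → (∀ i → NonZero (a i)) → (∀ j → NonZero (c j)) → SameUnion a b c d
  → ∀ β L → (∀ i → a i ∣ℕ L) → (∀ j → c j ∣ℕ L)
  → ∀ r → ⟪ levels β a b , weights β L a b ⟫ (λ x → 𝟙 (x ∣ℕ? r))
        ≡ ⟪ levels β c d , weights β L c d ⟫ (λ x → 𝟙 (x ∣ℕ? r))
same-divisor-sums a b c d a≢0 c≢0 same β L a∣L c∣L r =
  trans (sym (probe a b β L r a≢0 a∣L))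
        (trans (sum-cong-≗ {L} (λ t → same (+ toℕ t) (β ℤ.* + toℕ t ℤ.+ + r)))
               (probe c d β L r c≢0 c∣L))

∣-factorial : ∀ {m n} .{{_ : NonZero m}} → m ≤ n → m ∣ℕ n !
∣-factorial {suc m} m≤n = ℕ∣.∣-trans (ℕ∣.m∣m*n (m !)) (ℕ∣.m≤n⇒m!∣n! m≤n)

-- With L = A! both sides have equal weighted divisor sums of levels, hence by inversion
-- equal weight at level A. Class i has level gcd(A, 0) = A and positive weight, so some class
-- j on the right has level A: then A ∣ cⱼ ≤ A and A ∣ β - dⱼ.
match : ∀ {m n} (a : Fin m → ℕ) (b : Fin m → ℤ) (c : Fin n → ℕ) (d : Fin n → ℤ)
  → (∀ i → NonZero (a i)) → (∀ j → NonZero (c j)) → SameUnion a b c d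
  → ∀ i → (∀ i′ → a i′ ≤ a i) → (∀ j → c j ≤ a i)
  → ∃ λ j → SameClass (a i) (b i) (c j) (d j)
match a b c d a≢0 c≢0 same i a≤A c≤A = j , sym cⱼ≡A , A∣β-dⱼ
  where
  A = a i
  β = b i
  L = A !
  at-A : ℕ → ℕ
  at-A x = 𝟙 (x ℕ.≟ A)

  same-at-A : ⟪ levels β a b , weights β L a b ⟫ at-A ≡ ⟪ levels β c d , weights β L c d ⟫ at-A
  same-at-A = divisor-inversion (levels β a b) (weights β L a b) (levels β c d) (weights β L c d)
    (λ i′ → gcd[m,n]≢0 (a i′) _ (inj₁ (ℕ.≢-nonZero⁻¹ (a i′) {{a≢0 i′}})))
    (λ j → gcd[m,n]≢0 (c j) _ (inj₁ (ℕ.≢-nonZero⁻¹ (c j) {{c≢0 j}})))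
    (λ r → same-divisor-sums a b c d a≢0 c≢0 same β L
             (λ i′ → ∣-factorial {{a≢0 i′}} (a≤A i′)) (λ j → ∣-factorial {{c≢0 j}} (c≤A j)) (suc r))
    (suc A) at-A (λ x A<x → 𝟙-no (λ x≡A → ℕ.<-irrefl (sym x≡A) A<x) (x ℕ.≟ A))

  levelᵢ≡A : levels β a b i ≡ A
  levelᵢ≡A = trans (cong (λ z → gcd A ∣ z ∣) (+-inverseʳ β)) (gcd-identityʳ A)
  left-positive : 1 ≤ ⟪ levels β a b , weights β L a b ⟫ at-A
  left-positive = ℕ.≤-trans (solutions-positive A (β - β) L (ℕ.1≤n! A))
    (ℕ.≤-trans (ℕ.≤-reflexive (sym (trans (cong (weights β L a b i *_) (𝟙-yes levelᵢ≡A (levels β a b i ℕ.≟ A)))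
                                        (ℕ.*-identityʳ _))))
               (term≤sum (λ i′ → weights β L a b i′ * at-A (levels β a b i′)) i))

  right-level-A = level-witness (levels β c d) (weights β L c d) A (subst (1 ≤_) same-at-A left-positive)
  j = proj₁ right-level-A
  cⱼ≡A : c j ≡ A
  cⱼ≡A = ℕ.≤-antisym (c≤A j) (ℕ∣.∣⇒≤ {{c≢0 j}} (subst (_∣ℕ c j) (proj₂ right-level-A) (gcd[m,n]∣m (c j) _)))
  A∣β-dⱼ : (+ A) ∣ (β - d j)
  A∣β-dⱼ = subst (_∣ℕ ∣ β - d j ∣) (proj₂ right-level-A) (gcd[m,n]∣n (c j) _)

argmax : ∀ {m} (f : Fin (suc m) → ℕ) → ∃ λ i → ∀ k → f k ≤ f i
argmax {zero} f = Fin.zero , λ { Fin.zero → ℕ.≤-refl }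
argmax {suc m} f with argmax (λ k → f (Fin.suc k))
... | i , f≤fᵢ with f Fin.zero ℕ.≤? f (Fin.suc i)
...   | yes f₀≤fᵢ = Fin.suc i , λ { Fin.zero → f₀≤fᵢ ; (Fin.suc k) → f≤fᵢ k }
...   | no f₀≰fᵢ = Fin.zero , λ { Fin.zero → ℕ.≤-refl ; (Fin.suc k) → ℕ.≤-trans (f≤fᵢ k) (ℕ.<⇒≤ (ℕ.≰⇒> f₀≰fᵢ)) }

-- Two nonempty families with equal unions share a class: the largest modulus overall occurs
-- on one side, and match finds its partner on the other.
matched-pair : ∀ {m n} (a : Fin (suc m) → ℕ) (b : Fin (suc m) → ℤ) (c : Fin (suc n) → ℕ) (d : Fin (suc n) → ℤ)
  → (∀ i → NonZero (a i)) → (∀ j → NonZero (c j)) → SameUnion a b c d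
  → ∃₂ λ i j → SameClass (a i) (b i) (c j) (d j)
matched-pair a b c d a≢0 c≢0 same with argmax a | argmax c
... | i , a≤aᵢ | j , c≤cⱼ with c j ℕ.≤? a i
...   | yes cⱼ≤aᵢ =
  let (j′ , class) = match a b c d a≢0 c≢0 same i a≤aᵢ (λ l → ℕ.≤-trans (c≤cⱼ l) cⱼ≤aᵢ)
  in i , j′ , class
...   | no cⱼ≰aᵢ =
  let (i′ , class) = match c d a b c≢0 a≢0 (λ t x → sym (same t x)) j c≤cⱼ
                       (λ k → ℕ.≤-trans (a≤aᵢ k) (ℕ.<⇒≤ (ℕ.≰⇒> cⱼ≰aᵢ)))
  in i′ , j , SameClass-sym {c j} {d j} class

remove-pair : ∀ {m n} (a : Fin (suc m) → ℕ) (b : Fin (suc m) → ℤ) (c : Fin (suc n) → ℕ) (d : Fin (suc n) → ℤ)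
  → SameUnion a b c d → ∀ i j → SameClass (a i) (b i) (c j) (d j)
  → SameUnion (λ k → a (punchIn i k)) (λ k → b (punchIn i k)) (λ l → c (punchIn j l)) (λ l → d (punchIn j l))
remove-pair {m} {n} a b c d same i j class t x = ℕ.+-cancelˡ-≡ (member t x (a i) (b i)) _ _ (begin
  member t x (a i) (b i) + ∑[ k < m ] memberₐ (punchIn i k)   ≡⟨ sum-remove {i = i} memberₐ ⟨
  ∑[ k < suc m ] memberₐ k                                    ≡⟨ same t x ⟩
  ∑[ l < suc n ] member꜀ l                                    ≡⟨ sum-remove {i = j} member꜀ ⟩
  member t x (c j) (d j) + ∑[ l < n ] member꜀ (punchIn j l)   ≡⟨ cong (λ z → z + ∑[ l < n ] member꜀ (punchIn j l)) (member-class class t x) ⟨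
  member t x (a i) (b i) + ∑[ l < n ] member꜀ (punchIn j l)   ∎)
  where
  open ≡-Reasoning
  memberₐ : Fin (suc m) → ℕ
  memberₐ k = member t x (a k) (b k)
  member꜀ : Fin (suc n) → ℕ
  member꜀ l = member t x (c l) (d l)

-- If R relates i to j, and π relates the remaining positions, then insert i j π relates all
-- positions: by definition it sends i to j and punchIn i k to punchIn j (π k).
insert-relates : ∀ {m n} (R : Fin (suc m) → Fin (suc n) → Set) i j (π : Permutation m n)
  → R i j → (∀ k → R (punchIn i k) (punchIn j (π ⟨$⟩ʳ k)))
  → ∀ k → R k (Perm.insert i j π ⟨$⟩ʳ k)
insert-relates R i j π Rij Rrest k with i FinP.≟ k
... | yes refl = Rij
... | no i≢k = subst (λ l → R l (punchIn j (π ⟨$⟩ʳ punchOut i≢k))) (FinP.punchIn-punchOut i≢k)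
                 (Rrest (punchOut i≢k))

matching : ∀ n (a : Fin n → ℕ) (b : Fin n → ℤ) (c : Fin n → ℕ) (d : Fin n → ℤ)
  → (∀ i → NonZero (a i)) → (∀ j → NonZero (c j)) → SameUnion a b c d
  → Σ (Permutation n n) λ σ → ∀ i → SameClass (a i) (b i) (c (σ ⟨$⟩ʳ i)) (d (σ ⟨$⟩ʳ i))
matching zero a b c d _ _ _ = Perm.id , λ ()
matching (suc n) a b c d a≢0 c≢0 same =
  Perm.insert i j π , insert-relates (λ k l → SameClass (a k) (b k) (c l) (d l)) i j π class (proj₂ rest)
  where
  pair = matched-pair a b c d a≢0 c≢0 same
  i = proj₁ pair
  j = proj₁ (proj₂ pair)
  class = proj₂ (proj₂ pair)
  rest = matching n (λ k → a (punchIn i k)) (λ k → b (punchIn i k)) (λ l → c (punchIn j l)) (λ l → d (punchIn j l))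
           (λ k → a≢0 (punchIn i k)) (λ l → c≢0 (punchIn j l)) (remove-pair a b c d same i j class)
  π = proj₁ rest

proposition3p3 : (μ ν : ℕ) (a : Fin μ → ℕ) (b : Fin μ → ℤ) (c : Fin ν → ℕ) (d : Fin ν → ℤ)
    → (∀ i → NonZero (a i)) → (∀ j → NonZero (c j))
    → (∀ (t x : ℤ) → multiplicity μ a b t x ≡ multiplicity ν c d t x)
    → μ ≡ ν × Σ (Permutation μ ν) (λ σ →
        ∀ (i : Fin μ) → (a i ≡ c (σ ⟨$⟩ʳ i)) × ((+ a i) ∣ (b i - d (σ ⟨$⟩ʳ i))))
proposition3p3 μ ν a b c d a≢0 c≢0 same-multiplicity
  with trans (sym (multiplicity-origin μ a b)) (trans (same-multiplicity (+ 0) (+ 0)) (multiplicity-origin ν c d))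
... | refl = refl , matching μ a b c d a≢0 c≢0 same-union
  where
  same-union : SameUnion a b c d
  same-union t x = trans (sym (multiplicity-sum μ a b t x)) (trans (same-multiplicity t x) (multiplicity-sum μ c d t x))
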